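{- If $G$ is a graph having two vertices $u$ and $v$ such that $\deg(u)=1$, $\deg(v)=2$ and $d(u,v)=2$, then $G$ is not group vertex magic.
   Context: Graphs are finite, simple and undirected; $d(u,v)$ is the distance; in this part of the paper all Abelian groups are finite. For an additive Abelian group $\Gamma$ with identity $0$ and a graph $G$, a $\Gamma$-vertex magic labeling is a map $\ell:V(G)\to\Gamma\setminus\{0\}$ for which there is $\mu\in\Gamma$ with $w(v)=\sum_{y\in N(v)}\ell(y)=\mu$ for every vertex $v$; $G$ is group vertex magic if it is $\Gamma$-vertex magic for every nontrivial Abelian group $\Gamma$. -}

module Defs where

open import Level using (0ℓ)
open import Data.Nat using (ℕ; zero; suc; _+_)
open import Data.Fin using (Fin)
open import Data.Bool using (Bool; true; false; if_then_else_; T)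
open import Data.List using (List; foldr; map)
open import Data.List.Base using () renaming (allFin to allFinL)
open import Data.Product using (Σ; ∃; _×_; _,_)
open import Relation.Binary.PropositionalEquality using (_≡_)
open import Relation.Nullary using (¬_)
open import Algebra.Bundles using (AbelianGroup)

record Graph (n : ℕ) : Set where
  field
    adj    : Fin n → Fin n → Bool
    sym    : ∀ u v → adj u v ≡ adj v u
    irrefl : ∀ v → adj v v ≡ false

open Graph public

Adj : ∀ {n} → Graph n → Fin n → Fin n → Set
Adj G u v = T (adj G u v)

deg : ∀ {n} → Graph n → Fin n → ℕ
deg {n} G v = foldr _+_ 0 (map (λ y → if adj G v y then 1 else 0) (allFinL n))

data Walk {n : ℕ} (G : Graph n) : ℕ → Fin n → Fin n → Set where
  here : ∀ {v} → Walk G 0 v v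
  step : ∀ {k u x v} → Adj G u x → Walk G k x v → Walk G (suc k) u v

Dist≡2 : ∀ {n} → Graph n → Fin n → Fin n → Set
Dist≡2 G u v = Walk G 2 u v × ¬ Walk G 0 u v × ¬ Walk G 1 u v

module _ (A : AbelianGroup 0ℓ 0ℓ) where
  open AbelianGroup A renaming (Carrier to Γ)

  FiniteGroup : Set
  FiniteGroup = ∃ λ m → Σ (Fin m → Γ) λ f → ∀ x → ∃ λ i → f i ≈ x

  Nontrivial : Set
  Nontrivial = ∃ λ x → ¬ (x ≈ ε)

  weight : ∀ {n} → Graph n → (Fin n → Γ) → Fin n → Γ
  weight {n} G ℓ v = foldr _∙_ ε (map (λ y → if adj G v y then ℓ y else ε) (allFinL n))

  VertexMagic : ∀ {n} → Graph n → Set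
  VertexMagic {n} G =
    Σ (Fin n → Γ) λ ℓ → (∀ v → ¬ (ℓ v ≈ ε)) × (∃ λ μ → ∀ v → weight G ℓ v ≈ μ)

GroupVertexMagic : ∀ {n} → Graph n → Set₁
GroupVertexMagic G =
  (A : AbelianGroup 0ℓ 0ℓ) → FiniteGroup A → Nontrivial A → VertexMagic A G

{-# OPTIONS --safe #-}
module Submission where

open import Defs hiding (sym)
open import Data.Nat using (ℕ; parity)
import Data.Nat as ℕ
open import Data.Fin using (Fin; zero; suc)
open import Data.Bool using (true; false; if_then_else_)
open import Data.List using ([]; _∷_; foldr; map)
open import Data.List.Base using () renaming (allFin to allFinL)
open import Data.Parity.Base using (Parity; 0ℙ; 1ℙ; _+_)
open import Data.Parity.Properties using (+-0-abelianGroup; +-homo-+)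
open import Data.Product using (_,_)
open import Algebra.Bundles using (AbelianGroup)
open import Level using (0ℓ)
open import Relation.Binary.PropositionalEquality
  using (_≡_; refl; sym; trans; cong₂; module ≡-Reasoning)
open import Relation.Nullary using (¬_; contradiction)

ℤ₂ : AbelianGroup 0ℓ 0ℓ
ℤ₂ = +-0-abelianGroup

ℤ₂-finite : FiniteGroup ℤ₂
ℤ₂-finite = 2 , element , λ { 0ℙ → zero , refl ; 1ℙ → suc zero , refl }
  where
  element : Fin 2 → Parity
  element zero    = 0ℙ
  element (suc _) = 1ℙ

ℤ₂-nontrivial : Nontrivial ℤ₂
ℤ₂-nontrivial = 1ℙ , λ ()

≢0ℙ⇒≡1ℙ : ∀ {p} → ¬ p ≡ 0ℙ → p ≡ 1ℙ
≢0ℙ⇒≡1ℙ {0ℙ} p≢0ℙ = contradiction refl p≢0ℙ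
≢0ℙ⇒≡1ℙ {1ℙ} _    = refl

weight-ℤ₂-nowhereZero : ∀ {n} (G : Graph n) (ℓ : Fin n → Parity) → (∀ y → ¬ ℓ y ≡ 0ℙ) →
                        ∀ v → weight ℤ₂ G ℓ v ≡ parity (deg G v)
weight-ℤ₂-nowhereZero {n} G ℓ ℓ≢0ℙ v = sum≡parity-count (allFinL n)
  where
  open ≡-Reasoning

  term : Fin n → Parity
  term y = if adj G v y then ℓ y else 0ℙ

  indicator : Fin n → ℕ
  indicator y = if adj G v y then 1 else 0

  term≡parity-indicator : ∀ y → term y ≡ parity (indicator y)
  term≡parity-indicator y with adj G v y
  ... | true  = ≢0ℙ⇒≡1ℙ (ℓ≢0ℙ y)
  ... | false = refl

  sum≡parity-count : ∀ ys → foldr _+_ 0ℙ (map term ys) ≡ parity (foldr ℕ._+_ 0 (map indicator ys))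
  sum≡parity-count []       = refl
  sum≡parity-count (y ∷ ys) = begin
    term y + foldr _+_ 0ℙ (map term ys)
      ≡⟨ cong₂ _+_ (term≡parity-indicator y) (sum≡parity-count ys) ⟩
    parity (indicator y) + parity (foldr ℕ._+_ 0 (map indicator ys))
      ≡⟨ sym (+-homo-+ (indicator y) _) ⟩
    parity (indicator y ℕ.+ foldr ℕ._+_ 0 (map indicator ys))
      ∎

ℤ₂-vertexMagic⇒parity-deg-constant : ∀ {n} (G : Graph n) → VertexMagic ℤ₂ G →
                                     ∀ u v → parity (deg G u) ≡ parity (deg G v)
ℤ₂-vertexMagic⇒parity-deg-constant G (ℓ , ℓ≢0ℙ , μ , w≡μ) u v = begin
  parity (deg G u)    ≡⟨ sym (weight-ℤ₂-nowhereZero G ℓ ℓ≢0ℙ u) ⟩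
  weight ℤ₂ G ℓ u     ≡⟨ trans (w≡μ u) (sym (w≡μ v)) ⟩
  weight ℤ₂ G ℓ v     ≡⟨ weight-ℤ₂-nowhereZero G ℓ ℓ≢0ℙ v ⟩
  parity (deg G v)    ∎
  where open ≡-Reasoning

theorem2p3 : (n : ℕ) (G : Graph n) (u v : Fin n) →
    deg G u ≡ 1 → deg G v ≡ 2 → Dist≡2 G u v → ¬ GroupVertexMagic G
theorem2p3 n G u v deg-u≡1 deg-v≡2 _ magic
  with parity-u≡parity-v ← ℤ₂-vertexMagic⇒parity-deg-constant G
         (magic ℤ₂ ℤ₂-finite ℤ₂-nontrivial) u v
  rewrite deg-u≡1 | deg-v≡2
  with () ← parity-u≡parity-v
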